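{- The graded dual $\mathbf{ESym}:=\mathbf{EQSym}^*$ is free as an associative algebra over the set $\{\mathbf{S}^f \mid f \text{ a connected endofunction}\}$, where $(\mathbf{S}^f)$ is the basis dual to $(\mathbf{M}_f)$.
   Context: Let $\mathbb{K}$ be a field of characteristic zero. Let $R=\mathbb{K}[x_{i\,j}\mid i,j\geq 1]$ be the polynomial ring in commuting indeterminates $x_{i\,j}$, and let $\mathcal J$ be the ideal of $R$ generated by all products $x_{i\,j}x_{i\,k}$ ($i,j,k\geq1$). An endofunction of $[n]=\{1,\dots,n\}$ is any map $f:[n]\to[n]$ ($n\ge 0$). For such $f$ put $$\mathbf{M}_f=\sum_{i_1<\cdots<i_n} x_{i_1\,i_{f(1)}}\cdots x_{i_n\,i_{f(n)}}\in R/\mathcal J$$ (with $\mathbf{M}_f=1$ for $n=0$). The $\mathbf{M}_f$ (over all $n\ge0$ and all endofunctions $f$ of $[n]$) are linearly independent and span a subalgebra $\mathbf{EQSym}$ of $R/\mathcal J$, graded by $\deg \mathbf M_f=n$. The shifted concatenation of $f:[n]\to[n]$ and $g:[m]\to[m]$ is the endofunction $h=f\bullet g$ of $[n+m]$ with $h(i)=f(i)$ for $i\le n$ and $h(i)=n+g(i-n)$ for $i>n$. $\mathbf{EQSym}$ is a graded connected commutative Hopf algebra with coproduct $\Delta\mathbf M_h=\sum_{(f,g):\,f\bullet g=h}\mathbf M_f\otimes\mathbf M_g$ (the sum including the pairs with $f$ or $g$ the empty endofunction). $\mathbf{ESym}=\bigoplus_n(\mathbf{EQSym}_n)^*$ is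 its graded dual Hopf algebra, with product dual to $\Delta$ and coproduct dual to the product. An endofunction $f$ of $[n]$, $n\geq1$, is connected if it cannot be written as $f=g\bullet h$ with $g,h$ endofunctions of sets $[k]$, $[n-k]$ with $1\le k\le n-1$. -}

module Defs where

open import Level using (Level; _⊔_)
open import Algebra.Bundles using (CommutativeRing)
open import Data.Nat as ℕ using (ℕ; zero; suc; _≤_; _>_)
open import Data.Nat.Properties as ℕP using ()
open import Data.Fin as Fin using (Fin; _↑ˡ_; _↑ʳ_)
open import Data.Fin.Properties as FinP using ()
open import Data.Vec as Vec using (Vec; []; _∷_; _++_)
open import Data.Vec.Properties as VecP using ()
open import Data.List as List using (List; []; _∷_; allFin; concatMap; upTo; foldr)
open import Data.Product using (Σ; ∃; ∃-syntax; _×_; _,_; proj₁; proj₂)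
open import Relation.Nullary using (¬_; Dec; yes; no)
open import Relation.Binary.PropositionalEquality using (_≡_; refl; cong)

-- An endofunction of [n] is encoded as the vector (f(1),…,f(n)) of values
-- in Fin n (0-based).  Endo = all endofunctions of all [n], n ≥ 0.
Endo : Set
Endo = Σ ℕ (λ n → Vec (Fin n) n)

deg : Endo → ℕ
deg = proj₁

_•_ : Endo → Endo → Endo
(n , f) • (m , g) = (n ℕ.+ m , Vec.map (_↑ˡ m) f ++ Vec.map (n ↑ʳ_) g)

ε : Endo
ε = (0 , [])

IsConnected : Endo → Set
IsConnected f =
  (deg f ℕ.≥ 1) ×
  ¬ (∃[ g ] ∃[ h ] ((deg g ℕ.≥ 1) × (deg h ℕ.≥ 1) × (g • h ≡ f)))

ConnEndo : Set
ConnEndo = Σ Endo IsConnected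

_≟E_ : (f g : Endo) → Dec (f ≡ g)
(n , f) ≟E (m , g) with n ℕ.≟ m
... | no n≢m = no (λ eq → n≢m (cong proj₁ eq))
... | yes refl with VecP.≡-dec FinP._≟_ f g
...   | yes refl = yes refl
...   | no f≢g = no (λ { refl → f≢g refl })

_≟W_ : (u v : List Endo) → Dec (u ≡ v)
[] ≟W [] = yes refl
[] ≟W (_ ∷ _) = no (λ ())
(_ ∷ _) ≟W [] = no (λ ())
(x ∷ u) ≟W (y ∷ v) with x ≟E y | u ≟W v
... | yes refl | yes refl = yes refl
... | no x≢y | _ = no (λ { refl → x≢y refl })
... | _ | no u≢v = no (λ { refl → u≢v refl })

allVecs : (m k : ℕ) → List (Vec (Fin m) k)
allVecs m zero = [] ∷ []
allVecs m (suc k) = concatMap (λ i → List.map (i ∷_) (allVecs m k)) (allFin m)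

allEndo : ℕ → List Endo
allEndo k = List.map (k ,_) (allVecs k k)

allPairs : ℕ → List (Endo × Endo)
allPairs n =
  concatMap (λ k → concatMap (λ f → List.map (f ,_) (allEndo (n ℕ.∸ k))) (allEndo k))
            (upTo (suc n))

-- the pairs (f , g) with f • g = h  (the terms of the coproduct Δ M_h)
splittings : Endo → List (Endo × Endo)
splittings h = List.filter (λ p → (proj₁ p • proj₂ p) ≟E h) (allPairs (deg h))

module _ {c ℓ : Level} (K : CommutativeRing c ℓ) where
  open CommutativeRing K renaming (Carrier to A; refl to ≈-refl)

  _×1 : ℕ → A
  zero ×1 = 0#
  suc n ×1 = 1# + (n ×1)

  IsField : Set (c ⊔ ℓ)
  IsField = (¬ (1# ≈ 0#)) × (∀ x → ¬ (x ≈ 0#) → ∃[ y ] (x * y ≈ 1#))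

  CharZero : Set ℓ
  CharZero = ∀ n → (n ×1) ≈ 0# → n ≡ 0

  -- ESym = ⊕_n (EQSym_n)^*.  An element is a linear functional on EQSym,
  -- given by its values φ(f) = ⟨φ , M_f⟩ on the basis (M_f), with only
  -- finitely many nonzero graded components.

  sumK : List A → A
  sumK = foldr _+_ 0#

  Fn : Set c
  Fn = Endo → A

  record ESym : Set (c ⊔ ℓ) where
    field
      coeff  : Fn
      bound  : ℕ
      graded : ∀ f → deg f > bound → coeff f ≈ 0#
  open ESym public

  S : Endo → Fn
  S f g with g ≟E f
  ... | yes _ = 1#
  ... | no _ = 0#

  -- product dual to the coproduct Δ M_h = Σ_{f • g = h} M_f ⊗ M_g :
  -- ⟨φ ψ , M_h⟩ = Σ_{f • g = h} ⟨φ , M_f⟩ ⟨ψ , M_g⟩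
  _⋆_ : Fn → Fn → Fn
  (φ ⋆ ψ) h = sumK (List.map (λ p → φ (proj₁ p) * ψ (proj₂ p)) (splittings h))

  -- unit of ESym (dual to the counit of EQSym): S^∅
  unitES : Fn
  unitES = S ε

  zeroES : Fn
  zeroES _ = 0#

  _⊕_ : Fn → Fn → Fn
  (φ ⊕ ψ) h = φ h + ψ h

  _·_ : A → Fn → Fn
  (a · φ) h = a * φ h

  -- The free associative algebra K⟨X⟩ on X = {connected endofunctions}:
  -- elements are finite formal linear combinations of words in X.

  Word : Set
  Word = List ConnEndo

  word : Word → List Endo
  word = List.map proj₁

  FreeAlg : Set c
  FreeAlg = List (A × Word)

  coeffW : FreeAlg → Word → A
  coeffW p w = sumK (List.map (λ t → cf t) p)
    where
    cf : A × Word → A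
    cf (a , u) with word u ≟W word w
    ... | yes _ = a
    ... | no _ = 0#

  _≈FA_ : FreeAlg → FreeAlg → Set ℓ
  p ≈FA q = ∀ w → coeffW p w ≈ coeffW q w

  prodS : Word → Fn
  prodS [] = unitES
  prodS (f ∷ w) = S (proj₁ f) ⋆ prodS w

  Φ : FreeAlg → Fn
  Φ [] = zeroES
  Φ ((a , w) ∷ p) = (a · prodS w) ⊕ Φ p

  -- ESym is free as an associative algebra on {S^f | f connected}:
  -- the canonical algebra morphism K⟨X⟩ → ESym, x_f ↦ S^f, is well defined
  -- (lands in the graded dual) and is a bijection.
  ESymFreeOnConnected : Set (c ⊔ ℓ)
  ESymFreeOnConnected =
    (∀ p → ∃[ N ] (∀ f → deg f > N → Φ p f ≈ 0#)) ×
    (∀ p q → (∀ f → Φ p f ≈ Φ q f) → p ≈FA q) ×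
    (∀ (φ : ESym) → ∃[ p ] (∀ f → Φ p f ≈ coeff φ f))

-- Dually to the coproduct of EQSym, the product of ESym satisfies S^f S^g = S^(f • g): the pair
-- (f , g) is the only splitting of f • g into a piece of degree deg f and one of degree deg g.
-- Hence the word x_f₁ ⋯ x_fₖ is sent to S^(f₁ • ⋯ • fₖ), and freeness reduces to unique
-- factorisation in the monoid of endofunctions under •: every endofunction is a shifted
-- concatenation of connected ones (split while possible; degrees drop), and uniquely so, since
-- a connected endofunction has no proper nonempty left factor, so two factorisations agree on
-- their first factor. Surjectivity onto the graded dual holds because an element of bounded
-- degree is the finite sum of its coefficients times the S^f.
module Submission where

open import Level using (Level)
open import Algebra.Bundles using (CommutativeRing)
open import Data.Product using (_,_)
open import Defs

module Endofunctions where
  open import Data.Nat as ℕ using (ℕ; zero; suc; _+_; _∸_; _≤_; _<_; _≥_; s≤s; z≤n)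
  open import Data.Nat.Properties as ℕP using ()
  open import Data.Fin as Fin using (Fin; toℕ; _↑ˡ_; _↑ʳ_)
  open import Data.Fin.Properties as FinP using ()
  open import Data.Vec as Vec using (Vec; []; _∷_)
  open import Data.Vec.Properties as VecP using ()
  open import Data.List as List using (List; []; _∷_; _++_; map; length; concatMap; upTo)
  open import Data.List.Properties as LP using ()
  open import Data.List.Relation.Unary.All as All using (All; []; _∷_)
  import Data.List.Relation.Unary.All.Properties as AllP
  open import Data.List.Relation.Unary.AllPairs using ([]; _∷_)
  open import Data.List.Relation.Unary.Any as Any using (here; any?)
  open import Data.List.Membership.Propositional using (_∈_; find; lose)
  open import Data.List.Membership.Propositional.Properties
    using (∈-map⁺; ∈-map⁻; ∈-concatMap⁺; ∈-concatMap⁻; ∈-allFin; ∈-upTo⁺; ∈-filter⁺; ∈-filter⁻)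
  open import Data.List.Relation.Unary.Unique.Propositional using (Unique)
  import Data.List.Relation.Unary.Unique.Propositional.Properties as UniqueP
  open import Data.List.Relation.Binary.Disjoint.Propositional using (Disjoint)
  open import Data.Product using (∃-syntax; _×_; proj₁; proj₂)
  open import Data.Empty using (⊥-elim)
  open import Function using (id; _∘_)
  open import Relation.Nullary using (¬_; Dec; yes; no; _×-dec_)
  open import Relation.Binary.Definitions using (tri<; tri≈; tri>)
  open import Relation.Binary.PropositionalEquality
    using (_≡_; _≢_; refl; sym; trans; cong; cong₂; subst; subst₂; module ≡-Reasoning)

  ++-prefix : ∀ {A : Set} (xs ys xs′ ys′ : List A) → xs ++ ys ≡ xs′ ++ ys′ →
              length xs ≤ length xs′ → ∃[ zs ] (xs′ ≡ xs ++ zs × ys ≡ zs ++ ys′)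
  ++-prefix []       ys xs′        ys′ eq _ = xs′ , refl , eq
  ++-prefix (x ∷ xs) ys (x′ ∷ xs′) ys′ eq (s≤s ≤-len) with refl , eq′ ← LP.∷-injective eq
    with zs , xs′≡ , ys≡ ← ++-prefix xs ys xs′ ys′ eq′ ≤-len = zs , cong (x ∷_) xs′≡ , ys≡

  ++-injective : ∀ {A : Set} (xs xs′ : List A) {ys ys′} → xs ++ ys ≡ xs′ ++ ys′ →
                 length xs ≡ length xs′ → xs ≡ xs′ × ys ≡ ys′
  ++-injective []       []         eq _ = refl , eq
  ++-injective (x ∷ xs) (x′ ∷ xs′) eq ≡-len with refl , eq′ ← LP.∷-injective eq
    with xs≡ , ys≡ ← ++-injective xs xs′ eq′ (ℕP.suc-injective ≡-len) = cong (x ∷_) xs≡ , ys≡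

  -- Identities for • are proved on value lists, where the dependent Fin indices disappear.
  values : Endo → List ℕ
  values (_ , f) = map toℕ (Vec.toList f)

  length-values : ∀ f → length (values f) ≡ deg f
  length-values (_ , f) = trans (LP.length-map toℕ (Vec.toList f)) (VecP.length-toList f)

  values-injective : ∀ {f g} → values f ≡ values g → f ≡ g
  values-injective {n , f} {m , g} eq
    with refl ← trans (sym (length-values (n , f))) (trans (cong length eq) (length-values (m , g)))
    = cong (n ,_) (trans (sym (VecP.cast-is-id refl f))
                         (VecP.toList-injective refl f g (LP.map-injective FinP.toℕ-injective eq)))

  values-< : ∀ f → All (_< deg f) (values f)
  values-< (_ , f) = AllP.map⁺ (All.universal FinP.toℕ<n (Vec.toList f))

  toℕ-toList-map : ∀ {a b k} (h : Fin a → Fin b) (s : ℕ → ℕ) →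
                   (∀ i → toℕ (h i) ≡ s (toℕ i)) → (v : Vec (Fin a) k) →
                   map toℕ (Vec.toList (Vec.map h v)) ≡ map s (map toℕ (Vec.toList v))
  toℕ-toList-map h s toℕ-h []      = refl
  toℕ-toList-map h s toℕ-h (i ∷ v) = cong₂ _∷_ (toℕ-h i) (toℕ-toList-map h s toℕ-h v)

  values-• : ∀ f g → values (f • g) ≡ values f ++ map (deg f +_) (values g)
  values-• (n , f) (m , g) = begin
    map toℕ (Vec.toList (Vec.map (_↑ˡ m) f Vec.++ Vec.map (n ↑ʳ_) g))
      ≡⟨ cong (map toℕ) (VecP.toList-++ (Vec.map (_↑ˡ m) f) _) ⟩
    map toℕ (Vec.toList (Vec.map (_↑ˡ m) f) ++ Vec.toList (Vec.map (n ↑ʳ_) g))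
      ≡⟨ LP.map-++ toℕ (Vec.toList (Vec.map (_↑ˡ m) f)) _ ⟩
    map toℕ (Vec.toList (Vec.map (_↑ˡ m) f)) ++ map toℕ (Vec.toList (Vec.map (n ↑ʳ_) g))
      ≡⟨ cong₂ _++_ (trans (toℕ-toList-map _ id (λ i → FinP.toℕ-↑ˡ i m) f) (LP.map-id _))
                    (toℕ-toList-map _ (n +_) (FinP.toℕ-↑ʳ n) g) ⟩
    values (n , f) ++ map (n +_) (values (m , g)) ∎
    where open ≡-Reasoning

  •-assoc : ∀ f g h → (f • g) • h ≡ f • (g • h)
  •-assoc f g h = values-injective (begin
    values ((f • g) • h)
      ≡⟨ values-• (f • g) h ⟩
    values (f • g) ++ map (deg f + deg g +_) (values h)
      ≡⟨ cong (_++ map (deg f + deg g +_) (values h)) (values-• f g) ⟩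
    (values f ++ map (deg f +_) (values g)) ++ map (deg f + deg g +_) (values h)
      ≡⟨ LP.++-assoc (values f) _ _ ⟩
    values f ++ map (deg f +_) (values g) ++ map (deg f + deg g +_) (values h)
      ≡⟨ cong (λ hs → values f ++ map (deg f +_) (values g) ++ hs)
              (trans (LP.map-cong (ℕP.+-assoc (deg f) (deg g)) (values h)) (LP.map-∘ (values h))) ⟩
    values f ++ map (deg f +_) (values g) ++ map (deg f +_) (map (deg g +_) (values h))
      ≡⟨ cong (values f ++_) (LP.map-++ (deg f +_) (values g) _) ⟨
    values f ++ map (deg f +_) (values g ++ map (deg g +_) (values h))
      ≡⟨ cong (λ gh → values f ++ map (deg f +_) gh) (values-• g h) ⟨
    values f ++ map (deg f +_) (values (g • h))
      ≡⟨ values-• f (g • h) ⟨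
    values (f • (g • h))
      ∎)
    where open ≡-Reasoning

  •-identityˡ : ∀ f → ε • f ≡ f
  •-identityˡ f = values-injective (trans (values-• ε f) (LP.map-id (values f)))

  •-identityʳ : ∀ f → f • ε ≡ f
  •-identityʳ f = values-injective (trans (values-• f ε) (LP.++-identityʳ (values f)))

  values-•-≡ : ∀ a u b v → a • u ≡ b • v →
               values a ++ map (deg a +_) (values u) ≡ values b ++ map (deg b +_) (values v)
  values-•-≡ a u b v eq = trans (sym (values-• a u)) (trans (cong values eq) (values-• b v))

  •-cancel : ∀ a u b v → a • u ≡ b • v → deg a ≡ deg b → a ≡ b × u ≡ v
  •-cancel a u b v eq refl
    with a≡b , u≡v ← ++-injective (values a) (values b) (values-•-≡ a u b v eq)
                                  (trans (length-values a) (sym (length-values b)))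
    = values-injective a≡b , values-injective (LP.map-injective (ℕP.+-cancelˡ-≡ (deg a) _ _) u≡v)

  toFins : ∀ {n} (zs : List ℕ) → All (_< n) zs → Vec (Fin n) (length zs)
  toFins []       []            = []
  toFins (z ∷ zs) (z<n ∷ zs<n) = Fin.fromℕ< z<n ∷ toFins zs zs<n

  toℕ-toFins : ∀ {n} (zs : List ℕ) (zs<n : All (_< n) zs) →
               map toℕ (Vec.toList (toFins zs zs<n)) ≡ zs
  toℕ-toFins []       []            = refl
  toℕ-toFins (z ∷ zs) (z<n ∷ zs<n) = cong₂ _∷_ (FinP.toℕ-fromℕ< z<n) (toℕ-toFins zs zs<n)

  shifted-values : ∀ k zs → All (k ≤_) zs → All (_< k + length zs) zs →
                   ∃[ e ] map (k +_) (values e) ≡ zs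
  shifted-values k zs zs≥k zs<k+len = (length ws , toFins ws ws<len) , (begin
    map (k +_) (map toℕ (Vec.toList (toFins ws ws<len)))
      ≡⟨ cong (map (k +_)) (toℕ-toFins ws ws<len) ⟩
    map (k +_) (map (_∸ k) zs)
      ≡⟨ LP.map-∘ zs ⟨
    map (λ z → k + (z ∸ k)) zs
      ≡⟨ LP.map-id-local (All.map ℕP.m+[n∸m]≡n zs≥k) ⟩
    zs
      ∎)
    where
    open ≡-Reasoning
    ws = map (_∸ k) zs
    unshift-< : ∀ {z} → k ≤ z × z < k + length zs → z ∸ k < length ws
    unshift-< {z} (k≤z , z<) = subst (z ∸ k <_) (trans (ℕP.m+n∸m≡n k (length zs)) (sym (LP.length-map _ zs)))
                                     (ℕP.∸-monoˡ-< z< k≤z)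
    ws<len : All (_< length ws) ws
    ws<len = AllP.map⁺ (All.map unshift-< (All.zip (zs≥k , zs<k+len)))

  prefix-extension : ∀ a b zs → values b ≡ values a ++ zs → All (deg a ≤_) zs → ∃[ e ] a • e ≡ b
  prefix-extension a b zs b≡a++zs zs≥a =
    let e , shift-e≡zs = shifted-values (deg a) zs zs≥a zs<a+zs
    in e , values-injective (begin
      values (a • e)                        ≡⟨ values-• a e ⟩
      values a ++ map (deg a +_) (values e) ≡⟨ cong (values a ++_) shift-e≡zs ⟩
      values a ++ zs                        ≡⟨ b≡a++zs ⟨
      values b                              ∎)
    where
    open ≡-Reasoning
    b≡a+zs : deg b ≡ deg a + length zs
    b≡a+zs = begin
      deg b                          ≡⟨ length-values b ⟨
      length (values b)              ≡⟨ cong length b≡a++zs ⟩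
      length (values a ++ zs)        ≡⟨ LP.length-++ (values a) ⟩
      length (values a) + length zs  ≡⟨ cong (_+ length zs) (length-values a) ⟩
      deg a + length zs              ∎
    zs<a+zs : All (_< deg a + length zs) zs
    zs<a+zs = AllP.++⁻ʳ (values a) (subst₂ (λ n → All (_< n)) b≡a+zs b≡a++zs (values-< b))

  •-properPrefix : ∀ a u b v → a • u ≡ b • v → deg a < deg b → ∃[ e ] (deg e ≥ 1 × a • e ≡ b)
  •-properPrefix a u b v eq a<b
    with zs , b≡a++zs , shift-u≡zs++ ← ++-prefix (values a) _ (values b) _ (values-•-≡ a u b v eq)
           (subst₂ _≤_ (sym (length-values a)) (sym (length-values b)) (ℕP.<⇒≤ a<b))
    = let zs≥a = AllP.++⁻ˡ zs (subst (All (deg a ≤_)) shift-u≡zs++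
                                      (AllP.map⁺ (All.universal (ℕP.m≤m+n (deg a)) (values u))))
          e , ae≡b = prefix-extension a b zs b≡a++zs zs≥a
      in e , ℕP.+-cancelˡ-< (deg a) 0 (deg e)
               (subst₂ _<_ (sym (ℕP.+-identityʳ (deg a))) (sym (cong deg ae≡b)) a<b) , ae≡b

  concat : List Endo → Endo
  concat = List.foldr _•_ ε

  concat-++ : ∀ u w → concat (u ++ w) ≡ concat u • concat w
  concat-++ []      w = sym (•-identityˡ (concat w))
  concat-++ (f ∷ u) w = trans (cong (f •_) (concat-++ u w)) (sym (•-assoc f (concat u) (concat w)))

  endos : List ConnEndo → List Endo
  endos = map proj₁

  Decomposable : Endo → Set
  Decomposable f = ∃[ g ] ∃[ h ] (deg g ≥ 1 × deg h ≥ 1 × g • h ≡ f)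

  ε≢• : ∀ {f} g → deg f ≥ 1 → ε ≢ f • g
  ε≢• {suc _ , _} _ _ ()

  connected-noProperPrefix : ∀ a u b v → deg a ≥ 1 → IsConnected b → a • u ≡ b • v →
                             ¬ deg a < deg b
  connected-noProperPrefix a u b v a≥1 (_ , b-indecomposable) eq a<b =
    let e , e≥1 , ae≡b = •-properPrefix a u b v eq a<b
    in b-indecomposable (a , e , a≥1 , e≥1 , ae≡b)

  concat-injective : ∀ u w → concat (endos u) ≡ concat (endos w) → endos u ≡ endos w
  concat-injective []                  []                  _  = refl
  concat-injective []                  ((f , f≥1 , _) ∷ w) eq = ⊥-elim (ε≢• (concat (endos w)) f≥1 eq)
  concat-injective ((f , f≥1 , _) ∷ u) []                  eq = ⊥-elim (ε≢• (concat (endos u)) f≥1 (sym eq))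
  concat-injective ((f , f-conn) ∷ u)  ((g , g-conn) ∷ w)  eq with ℕP.<-cmp (deg f) (deg g)
  ... | tri< f<g _ _ = ⊥-elim (connected-noProperPrefix f _ g _ (proj₁ f-conn) g-conn eq f<g)
  ... | tri> _ _ g<f = ⊥-elim (connected-noProperPrefix g _ f _ (proj₁ g-conn) f-conn (sym eq) g<f)
  ... | tri≈ _ f≡g _ = let f≡g , u≡w = •-cancel f _ g _ eq f≡g in cong₂ _∷_ f≡g (concat-injective u w u≡w)

  ∈-concatMap : ∀ {A B : Set} (F : A → List B) {x y xs} → x ∈ xs → y ∈ F x → y ∈ concatMap F xs
  ∈-concatMap F x∈xs y∈Fx = ∈-concatMap⁺ F (Any.map (λ { refl → y∈Fx }) x∈xs)

  ∈-map-key : ∀ {A B C : Set} (key : B → A) {g : C → B} {x y zs} →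
              (∀ z → key (g z) ≡ x) → y ∈ map g zs → key y ≡ x
  ∈-map-key key key-g y∈ with _ , _ , refl ← ∈-map⁻ _ y∈ = key-g _

  -- The blocks F x are told apart by a key, so they are pairwise disjoint.
  concatMap-unique : ∀ {A B : Set} {F : A → List B} (key : B → A) →
                     (∀ {x y} → y ∈ F x → key y ≡ x) → (∀ x → Unique (F x)) →
                     ∀ {xs} → Unique xs → Unique (concatMap F xs)
  concatMap-unique key keyF uF []                        = []
  concatMap-unique {F = F} key keyF uF {x ∷ xs} (x∉xs ∷ uxs) =
    UniqueP.++⁺ (uF x) (concatMap-unique key keyF uF uxs) disjoint
    where
    disjoint : Disjoint (F x) (concatMap F xs)
    disjoint (y∈Fx , y∈Fxs) with x′ , x′∈xs , y∈Fx′ ← find (∈-concatMap⁻ F y∈Fxs)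
      = All.lookup x∉xs x′∈xs (trans (sym (keyF y∈Fx)) (keyF y∈Fx′))

  ∈-allVecs : ∀ {m k} (v : Vec (Fin m) k) → v ∈ allVecs m k
  ∈-allVecs []      = here refl
  ∈-allVecs (i ∷ v) = ∈-concatMap _ (∈-allFin i) (∈-map⁺ (i ∷_) (∈-allVecs v))

  allVecs-unique : ∀ m k → Unique (allVecs m k)
  allVecs-unique m zero    = [] ∷ []
  allVecs-unique m (suc k) =
    concatMap-unique Vec.head (∈-map-key Vec.head (λ _ → refl))
      (λ i → UniqueP.map⁺ VecP.∷-injectiveʳ (allVecs-unique m k)) (UniqueP.allFin⁺ m)

  ∈-allEndo : ∀ f → f ∈ allEndo (deg f)
  ∈-allEndo (_ , v) = ∈-map⁺ _ (∈-allVecs v)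

  allEndo-unique : ∀ k → Unique (allEndo k)
  allEndo-unique k = UniqueP.map⁺ (λ { refl → refl }) (allVecs-unique k k)

  ∈-allPairs : ∀ {f g n} → deg f + deg g ≡ n → (f , g) ∈ allPairs n
  ∈-allPairs {f} {g} refl =
    ∈-concatMap _ (∈-upTo⁺ (s≤s (ℕP.m≤m+n (deg f) (deg g))))
      (∈-concatMap _ (∈-allEndo f) (∈-map⁺ (f ,_) g∈))
    where
    g∈ : g ∈ allEndo (deg f + deg g ∸ deg f)
    g∈ = subst (λ k → g ∈ allEndo k) (sym (ℕP.m+n∸m≡n (deg f) (deg g))) (∈-allEndo g)

  allPairs-unique : ∀ n → Unique (allPairs n)
  allPairs-unique n =
    concatMap-unique (deg ∘ proj₁) first-deg
      (λ k → concatMap-unique proj₁ (∈-map-key proj₁ (λ _ → refl))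
               (λ f → UniqueP.map⁺ (λ { refl → refl }) (allEndo-unique (n ∸ k))) (allEndo-unique k))
      (UniqueP.upTo⁺ (suc n))
    where
    first-deg : ∀ {k p} → p ∈ concatMap (λ f → map (f ,_) (allEndo (n ∸ k))) (allEndo k) →
                deg (proj₁ p) ≡ k
    first-deg {k} p∈
      with f , f∈ , p∈f ← find (∈-concatMap⁻ (λ f → map (f ,_) (allEndo (n ∸ k))) {allEndo k} p∈)
      = trans (cong deg (∈-map-key proj₁ (λ _ → refl) p∈f)) (∈-map-key deg (λ _ → refl) f∈)

  ∈-splittings : ∀ {f g h} → f • g ≡ h → (f , g) ∈ splittings h
  ∈-splittings fg≡h =
    ∈-filter⁺ (λ p → (proj₁ p • proj₂ p) ≟E _) (∈-allPairs (cong deg fg≡h)) fg≡h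

  splittings-sound : ∀ {p h} → p ∈ splittings h → proj₁ p • proj₂ p ≡ h
  splittings-sound {h = h} p∈ =
    proj₂ (∈-filter⁻ (λ p → (proj₁ p • proj₂ p) ≟E h) {xs = allPairs (deg h)} p∈)

  splittings-unique : ∀ h → Unique (splittings h)
  splittings-unique h = UniqueP.filter⁺ (λ p → (proj₁ p • proj₂ p) ≟E h) (allPairs-unique (deg h))

  allEndoUpTo : ℕ → List Endo
  allEndoUpTo N = concatMap allEndo (upTo (suc N))

  ∈-allEndoUpTo : ∀ {f N} → deg f ≤ N → f ∈ allEndoUpTo N
  ∈-allEndoUpTo {f} f≤N = ∈-concatMap allEndo (∈-upTo⁺ (s≤s f≤N)) (∈-allEndo f)

  allEndoUpTo-unique : ∀ N → Unique (allEndoUpTo N)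
  allEndoUpTo-unique N =
    concatMap-unique deg (∈-map-key deg (λ _ → refl)) allEndo-unique (UniqueP.upTo⁺ (suc N))

  decomposable? : ∀ f → Dec (Decomposable f)
  decomposable? f
    with any? (λ p → (1 ℕP.≤? deg (proj₁ p)) ×-dec (1 ℕP.≤? deg (proj₂ p))) (splittings f)
  ... | yes some with (g , h) , gh∈ , (g≥1 , h≥1) ← find some =
    yes (g , h , g≥1 , h≥1 , splittings-sound {h = f} gh∈)
  ... | no none =
    no λ (g , h , g≥1 , h≥1 , gh≡f) → none (lose (∈-splittings {g} {h} {f} gh≡f) (g≥1 , h≥1))

  factors-deg< : ∀ {g h f} → deg g ≥ 1 → deg h ≥ 1 → g • h ≡ f → deg g < deg f × deg h < deg f
  factors-deg< {g} {h} g≥1 h≥1 refl = ℕP.m<m+n (deg g) h≥1 , ℕP.m<n+m (deg h) g≥1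

  factoriseWithin : ∀ k f → deg f ≤ k → ∃[ w ] concat (endos w) ≡ f
  factoriseWithin _ (zero , []) _ = [] , refl
  factoriseWithin k f@(suc _ , _) _ with decomposable? f
  ... | no indecomposable = (f , s≤s z≤n , indecomposable) ∷ [] , •-identityʳ f
  factoriseWithin (suc k) f@(suc _ , _) (s≤s f≤k) | yes (g , h , g≥1 , h≥1 , gh≡f)
    with g<f , h<f ← factors-deg< {g} {h} {f} g≥1 h≥1 gh≡f
    with u , gu ← factoriseWithin k g (ℕP.≤-trans (ℕ.s≤s⁻¹ g<f) f≤k)
       | w , hw ← factoriseWithin k h (ℕP.≤-trans (ℕ.s≤s⁻¹ h<f) f≤k)
    = u ++ w , (begin
        concat (endos (u ++ w))             ≡⟨ cong concat (LP.map-++ proj₁ u w) ⟩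
        concat (endos u ++ endos w)         ≡⟨ concat-++ (endos u) (endos w) ⟩
        concat (endos u) • concat (endos w) ≡⟨ cong₂ _•_ gu hw ⟩
        g • h                               ≡⟨ gh≡f ⟩
        f                                   ∎)
    where open ≡-Reasoning

  factorise : Endo → List ConnEndo
  factorise f = proj₁ (factoriseWithin (deg f) f ℕP.≤-refl)

  concat-factorise : ∀ f → concat (endos (factorise f)) ≡ f
  concat-factorise f = proj₂ (factoriseWithin (deg f) f ℕP.≤-refl)

module DualBasis {c ℓ : Level} (K : CommutativeRing c ℓ) where
  open import Data.Nat as ℕ using (_>_)
  open import Data.Nat.Properties as ℕP using ()
  open import Data.List using ([]; _∷_; map)
  open import Data.List.Relation.Unary.All as All using ()
  open import Data.List.Relation.Unary.AllPairs using (_∷_)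
  open import Data.List.Relation.Unary.Any using (here; there)
  open import Data.List.Membership.Propositional using (_∈_)
  open import Data.List.Relation.Unary.Unique.Propositional using (Unique)
  open import Data.Product using (∃-syntax; _×_; proj₁; proj₂)
  open import Data.Empty using (⊥-elim)
  open import Function using (_∘_)
  open import Relation.Nullary using (Dec; yes; no)
  open import Relation.Binary.PropositionalEquality using (_≡_; _≢_; refl; sym; cong; ≢-sym)
  open CommutativeRing K
    renaming (Carrier to A; refl to ≈-refl; sym to ≈-sym; trans to ≈-trans; reflexive to ≈-reflexive)
  open import Relation.Binary.Reasoning.Setoid setoid
  open Endofunctions

  S-≡ : ∀ {f h} → h ≡ f → S K f h ≈ 1#
  S-≡ {f} {h} h≡f with h ≟E f
  ... | yes _   = ≈-refl
  ... | no h≢f = ⊥-elim (h≢f h≡f)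

  S-≢ : ∀ {f h} → h ≢ f → S K f h ≈ 0#
  S-≢ {f} {h} h≢f with h ≟E f
  ... | yes h≡f = ⊥-elim (h≢f h≡f)
  ... | no _    = ≈-refl

  sumK-map-cong : ∀ {X : Set} {F G : X → A} → (∀ x → F x ≈ G x) →
                  ∀ xs → sumK K (map F xs) ≈ sumK K (map G xs)
  sumK-map-cong F≈G []       = ≈-refl
  sumK-map-cong F≈G (x ∷ xs) = +-cong (F≈G x) (sumK-map-cong F≈G xs)

  sumK-vanishing : ∀ {X : Set} (δ : X → A) xs → (∀ {y} → y ∈ xs → δ y ≈ 0#) →
                   sumK K (map δ xs) ≈ 0#
  sumK-vanishing δ []       _   = ≈-refl
  sumK-vanishing δ (x ∷ xs) δ≈0 =
    ≈-trans (+-cong (δ≈0 (here refl)) (sumK-vanishing δ xs (δ≈0 ∘ there))) (+-identityʳ 0#)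

  sumK-delta : ∀ {X : Set} (δ : X → A) {x a xs} → δ x ≈ a → (∀ {y} → y ≢ x → δ y ≈ 0#) →
               Unique xs → x ∈ xs → sumK K (map δ xs) ≈ a
  sumK-delta δ {a = a} {x ∷ xs} δx≈a off (x∉xs ∷ _) (here refl) = begin
    δ x + sumK K (map δ xs)
      ≈⟨ +-cong δx≈a (sumK-vanishing δ xs (λ y∈xs → off (≢-sym (All.lookup x∉xs y∈xs)))) ⟩
    a + 0#
      ≈⟨ +-identityʳ a ⟩
    a ∎
  sumK-delta δ {a = a} {y ∷ xs} δx≈a off (y∉xs ∷ uxs) (there x∈xs) = begin
    δ y + sumK K (map δ xs)
      ≈⟨ +-cong (off (All.lookup y∉xs x∈xs)) (sumK-delta δ δx≈a off uxs x∈xs) ⟩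
    0# + a
      ≈⟨ +-identityˡ a ⟩
    a ∎

  S⊗S : Endo → Endo → Endo × Endo → A
  S⊗S f g (a , b) = S K f a * S K g b

  S⊗S-≡ : ∀ f g → S⊗S f g (f , g) ≈ 1#
  S⊗S-≡ f g = ≈-trans (*-cong (S-≡ {f} refl) (S-≡ {g} refl)) (*-identityˡ 1#)

  S⊗S-≢ : ∀ {f g p} → p ≢ (f , g) → S⊗S f g p ≈ 0#
  S⊗S-≢ {f} {g} {a , b} p≢fg = vanishes (a ≟E f)
    where
    vanishes : Dec (a ≡ f) → S⊗S f g (a , b) ≈ 0#
    vanishes (yes refl) = ≈-trans (*-congˡ (S-≢ (λ b≡g → p≢fg (cong (a ,_) b≡g)))) (zeroʳ _)
    vanishes (no a≢f)   = ≈-trans (*-congʳ (S-≢ a≢f)) (zeroˡ _)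

  -- (f , g) occurs exactly once in splittings (f • g), and in no other splittings h.
  S⋆S : ∀ f g h → _⋆_ K (S K f) (S K g) h ≈ S K (f • g) h
  S⋆S f g h with (f • g) ≟E h
  ... | yes refl = begin
    sumK K (map (S⊗S f g) (splittings (f • g)))
      ≈⟨ sumK-delta (S⊗S f g) (S⊗S-≡ f g) S⊗S-≢ (splittings-unique (f • g)) (∈-splittings refl) ⟩
    1#                  ≈⟨ S-≡ {f • g} refl ⟨
    S K (f • g) (f • g) ∎
  ... | no fg≢h = begin
    sumK K (map (S⊗S f g) (splittings h))
      ≈⟨ sumK-vanishing (S⊗S f g) (splittings h)
           (λ {p} p∈ → S⊗S-≢ {f} {g} {p} (λ { refl → fg≢h (splittings-sound {h = h} p∈) })) ⟩
    0#            ≈⟨ S-≢ (≢-sym fg≢h) ⟨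
    S K (f • g) h ∎

  ⋆-congʳ : ∀ {φ ψ ψ′ : Fn K} → (∀ g → ψ g ≈ ψ′ g) →
            ∀ h → _⋆_ K φ ψ h ≈ _⋆_ K φ ψ′ h
  ⋆-congʳ ψ≈ψ′ h = sumK-map-cong (λ p → *-congˡ (ψ≈ψ′ (proj₂ p))) (splittings h)

  prodS≈S-concat : ∀ w h → prodS K w h ≈ S K (concat (endos w)) h
  prodS≈S-concat []      h = ≈-refl
  prodS≈S-concat (f ∷ w) h =
    ≈-trans (⋆-congʳ (prodS≈S-concat w) h) (S⋆S (proj₁ f) (concat (endos w)) h)

  prodS-vanishes : ∀ w {f} → deg f > deg (concat (endos w)) → prodS K w f ≈ 0#
  prodS-vanishes w f>w =
    ≈-trans (prodS≈S-concat w _) (S-≢ (λ f≡w → ℕP.<⇒≢ f>w (cong deg (sym f≡w))))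

  Φ-graded : ∀ p → ∃[ N ] (∀ f → deg f > N → Φ K p f ≈ 0#)
  Φ-graded []            = 0 , λ _ _ → ≈-refl
  Φ-graded ((a , w) ∷ p) with N , Φp-graded ← Φ-graded p =
    deg (concat (endos w)) ℕ.⊔ N , λ f f>max → begin
      a * prodS K w f + Φ K p f
        ≈⟨ +-cong (*-congˡ (prodS-vanishes w (ℕP.≤-<-trans (ℕP.m≤m⊔n _ N) f>max)))
                  (Φp-graded f (ℕP.≤-<-trans (ℕP.m≤n⊔m _ N) f>max)) ⟩
      a * 0# + 0# ≈⟨ +-identityʳ _ ⟩
      a * 0#      ≈⟨ zeroʳ a ⟩
      0#          ∎

  coeffW≈Φ-concat : ∀ p w → coeffW K p w ≈ Φ K p (concat (endos w))
  coeffW≈Φ-concat []            w = ≈-refl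
  coeffW≈Φ-concat ((a , u) ∷ p) w with word K u ≟W word K w
  ... | yes u≡w = +-cong (≈-sym (≈-trans (*-congˡ coeff-one) (*-identityʳ a))) (coeffW≈Φ-concat p w)
    where
    coeff-one : prodS K u (concat (endos w)) ≈ 1#
    coeff-one = ≈-trans (prodS≈S-concat u _) (S-≡ (cong concat (sym u≡w)))
  ... | no u≢w  = +-cong (≈-sym (≈-trans (*-congˡ coeff-zero) (zeroʳ a))) (coeffW≈Φ-concat p w)
    where
    coeff-zero : prodS K u (concat (endos w)) ≈ 0#
    coeff-zero = ≈-trans (prodS≈S-concat u _) (S-≢ (λ w≡u → u≢w (sym (concat-injective w u w≡u))))

  Φ-injective : ∀ p q → (∀ f → Φ K p f ≈ Φ K q f) → _≈FA_ K p q
  Φ-injective p q Φp≈Φq w = begin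
    coeffW K p w                ≈⟨ coeffW≈Φ-concat p w ⟩
    Φ K p (concat (endos w))    ≈⟨ Φp≈Φq _ ⟩
    Φ K q (concat (endos w))    ≈⟨ coeffW≈Φ-concat q w ⟨
    coeffW K q w                ∎

  Φ-factorise : ∀ (F : Endo → A) fs h →
                Φ K (map (λ f → F f , factorise f) fs) h ≈ sumK K (map (λ f → F f * S K f h) fs)
  Φ-factorise F []       h = ≈-refl
  Φ-factorise F (f ∷ fs) h =
    +-cong (*-congˡ (≈-trans (prodS≈S-concat (factorise f) h)
                             (≈-reflexive (cong (λ g → S K g h) (concat-factorise f)))))
           (Φ-factorise F fs h)

  Φ-surjective : ∀ (φ : ESym K) → ∃[ p ] (∀ f → Φ K p f ≈ coeff φ f)
  Φ-surjective φ =
    map (λ f → coeff φ f , factorise f) (allEndoUpTo (bound φ)) ,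
    λ h → ≈-trans (Φ-factorise (coeff φ) (allEndoUpTo (bound φ)) h) (expansion h)
    where
    term : Endo → Endo → A
    term h f = coeff φ f * S K f h
    expansion : ∀ h → sumK K (map (term h) (allEndoUpTo (bound φ))) ≈ coeff φ h
    expansion h with deg h ℕP.≤? bound φ
    ... | yes h≤N = sumK-delta (term h) (≈-trans (*-congˡ (S-≡ {h} refl)) (*-identityʳ _))
                      (λ f≢h → ≈-trans (*-congˡ (S-≢ (≢-sym f≢h))) (zeroʳ _))
                      (allEndoUpTo-unique (bound φ)) (∈-allEndoUpTo h≤N)
    ... | no h≰N  = ≈-trans (sumK-vanishing (term h) (allEndoUpTo (bound φ)) (λ {f} _ → term-vanishes f))
                            (≈-sym (graded φ h h>N))
      where
      h>N : deg h > bound φ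
      h>N = ℕP.≰⇒> h≰N
      term-vanishes : ∀ f → term h f ≈ 0#
      term-vanishes f with f ≟E h
      ... | yes refl = ≈-trans (*-congʳ (graded φ h h>N)) (zeroˡ _)
      ... | no f≢h   = ≈-trans (*-congˡ (S-≢ (≢-sym f≢h))) (zeroʳ _)

mainTheorem1 : ∀ {c ℓ : Level} (K : CommutativeRing c ℓ) →
    IsField K → CharZero K → ESymFreeOnConnected K
mainTheorem1 K _ _ = Φ-graded , Φ-injective , Φ-surjective
  where open DualBasis K
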